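{- Let $(V,E)$ be a hypergraph, let $p\in(0,1/2)$, and let $t:V\to[0,1)$ be an injective birth time assignment with respect to which no edge is degenerate. If the Multipass Greedy Coloring procedure $MGC$ run on input $t$ produces a coloring which is not proper (some edge is monochromatic), then there exists a complete conflicting chain with respect to $t$.
   Context: A hypergraph $(V,E)$ has finite vertex set $V$ and a family $E$ of subsets (edges). Fix $p\in(0,1/2)$ and partition $[0,1)$ into $B=[0,\frac{1-p}{2})$, $P_B=[\frac{1-p}{2},\frac12)$, $R=[\frac12,1-\frac p2)$, $P_R=[1-\frac p2,1)$; regard $[0,1)$ as a circle of unit circumference, so these are arcs. For $v\in V$, $t(v)$ is its birth time, and we say $v$ lies in an interval if $t(v)$ does. An edge $f$ is degenerate if $t[f]\subseteq P_B\cup P_R$, and easy if $t[f]\cap B\ne\emptyset$ and $t[f]\cap R\ne\emptyset$. Any arc of the circle other than the whole circle induces a clockwise order on vertices with birth times in that arc. For an edge $f$ that is neither degenerate nor easy: if $t[f]\cap R=\emptyset$, its first and last vertices are the first and last vertices of $f$ in the clockwise order of the arc $P_R\cup B\cup P_B$ (from $1-p/2$ clockwise through $0$ to $1/2$); if $t[f]\cap B=\emptyset$, they are the first and last in the clockwise order of the arc $P_B\cup R\cup P_R$. Procedure $MGC$ (input: injective $t$ making no edge degenerate): color blue every vertex in $B\cup P_B$ and red every vertex in $R\cup P_R$. Let $b_1,\ldots,b_\alpha$ be the vertices in $P_B$ in increasing order of birth time and $r_1,\ldots,r_\beta$ those in $P_R$ in increasing order of birth time. While the current coloring has a blue edge whose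 last vertex is in $P_B$ or a red edge whose last vertex is in $P_R$: for $i=1,\ldots,\alpha$, if $b_i$ is the last vertex of a (currently) blue edge, recolor $b_i$ red; then for $i=1,\ldots,\beta$, if $r_i$ is the last vertex of a currently red edge, recolor $r_i$ blue. Return the final coloring. A sequence of edges $(s_1,\ldots,s_r)$ is a chain if $|s_i\cap s_{i+1}|=1$ for $i\in[r-1]$ and the sets $s_i\cap s_{i+1}$ are pairwise disjoint; writing $s_i\cap s_{i+1}=\{v_i\}$, $(v_1,\ldots,v_{r-1})$ is its corresponding vertex sequence. A chain is alternating (w.r.t. $t$) if none of its edges is easy or degenerate, and for each $i\in[r-1]$ the last vertex of $s_{i+1}$ is the first vertex of $s_i$ and $v_i\in P_B\cup P_R$. It is conflicting if it is alternating and the last vertex of $s_1$ lies in $B\cup R$, and complete conflicting if moreover the first vertex of $s_r$ lies in $B\cup R$.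
   Formalization: The parameter p and the birth times $t(v)$ take rational values. -}

module Defs where

open import Data.Bool using (Bool; true; false; if_then_else_; _∧_; _∨_; not)
open import Data.Nat using (ℕ; zero; suc)
open import Data.Fin using (Fin; zero; suc; inject₁)
open import Data.Fin.Subset using (Subset; _∈_; _∩_; ⁅_⁆; inside; outside)
open import Data.Vec using (lookup)
open import Data.List using (List; []; _∷_; foldl; filterᵇ)
open import Data.Bool.ListAction using (all; any)
open import Relation.Nullary using (yes; no)
open import Data.Fin using (_≟_)
open import Data.List.Membership.Propositional renaming (_∈_ to _∈ˡ_)
open import Data.Rational using (ℚ; 0ℚ; 1ℚ; ½; _+_; _-_; _*_; _≤_; _<_; _≤ᵇ_)
open import Data.Product using (_×_; ∃; Σ; _,_)
open import Data.Sum using (_⊎_)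
open import Data.Empty using (⊥)
open import Relation.Binary.PropositionalEquality using (_≡_)
open import Function.Definitions using (Injective)

allFin : (n : ℕ) → List (Fin n)
allFin zero    = []
allFin (suc n) = zero ∷ Data.List.map suc (allFin n)

_<ᵇ_ : ℚ → ℚ → Bool
x <ᵇ y = not (y ≤ᵇ x)

_∈ᵇ_ : ∀ {n} → Fin n → Subset n → Bool
v ∈ᵇ f with lookup f v
... | inside  = true
... | outside = false

data Region : Set where
  B PB R PR : Region

region : ℚ → ℚ → Region
region p x =
  if x <ᵇ ((1ℚ - p) * ½) then B
  else if x <ᵇ ½ then PB
  else if x <ᵇ (1ℚ - p * ½) then R
  else PR

isBᵇ isPBᵇ isRᵇ isPRᵇ : Region → Bool
isBᵇ B = true
isBᵇ _ = false
isPBᵇ PB = true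
isPBᵇ _ = false
isRᵇ R = true
isRᵇ _ = false
isPRᵇ PR = true
isPRᵇ _ = false

InP : Region → Set
InP r = (r ≡ PB) ⊎ (r ≡ PR)

InBR : Region → Set
InBR r = (r ≡ B) ⊎ (r ≡ R)

module _ {n : ℕ} (p : ℚ) (t : Fin n → ℚ) where

  reg : Fin n → Region
  reg v = region p (t v)

  Degenerate : Subset n → Set
  Degenerate f = ∀ u → u ∈ f → InP (reg u)

  Easy : Subset n → Set
  Easy f = (∃ λ u → u ∈ f × reg u ≡ B) × (∃ λ u → u ∈ f × reg u ≡ R)

  meetsRᵇ : Subset n → Bool
  meetsRᵇ f = any (λ u → u ∈ᵇ f ∧ isRᵇ (reg u)) (allFin n)

  -- Position of a vertex in the clockwise order of the relevant arc.
  -- If t[f] ∩ R = ∅: arc P_R ∪ B ∪ P_B starting at 1 - p/2, so vertices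
  -- in P_R come first: position t(u) - 1 for u ∈ P_R, t(u) otherwise.
  -- If t[f] ∩ B = ∅ (used when f meets R): arc P_B ∪ R ∪ P_R, position t(u).
  key : Subset n → Fin n → ℚ
  key f u = if meetsRᵇ f then t u
            else (if isPRᵇ (reg u) then t u - 1ℚ else t u)

  IsLast : Subset n → Fin n → Set
  IsLast f v = v ∈ f × (∀ u → u ∈ f → key f u ≤ key f v)

  IsFirst : Subset n → Fin n → Set
  IsFirst f v = v ∈ f × (∀ u → u ∈ f → key f v ≤ key f u)

  isLastᵇ : Subset n → Fin n → Bool
  isLastᵇ f v = (v ∈ᵇ f) ∧ all (λ u → not (u ∈ᵇ f) ∨ (key f u ≤ᵇ key f v)) (allFin n)

  data Color : Set where
    blue red : Color

  isBlueᵇ isRedᵇ : Color → Bool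
  isBlueᵇ blue = true
  isBlueᵇ red  = false
  isRedᵇ c = not (isBlueᵇ c)

  Coloring : Set
  Coloring = Fin n → Color

  initialColoring : Coloring
  initialColoring v with reg v
  ... | B  = blue
  ... | PB = blue
  ... | R  = red
  ... | PR = red

  Monochromatic : Coloring → Subset n → Set
  Monochromatic c f = (∀ u → u ∈ f → c u ≡ blue) ⊎ (∀ u → u ∈ f → c u ≡ red)

  blueEdgeᵇ redEdgeᵇ : Coloring → Subset n → Bool
  blueEdgeᵇ c f = all (λ u → not (u ∈ᵇ f) ∨ isBlueᵇ (c u)) (allFin n)
  redEdgeᵇ  c f = all (λ u → not (u ∈ᵇ f) ∨ isRedᵇ (c u)) (allFin n)

  recolor : Coloring → Fin n → Color → Coloring
  recolor c v col u with u ≟ v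
  ... | yes _ = col
  ... | no  _ = c u

  insertBy : Fin n → List (Fin n) → List (Fin n)
  insertBy v [] = v ∷ []
  insertBy v (w ∷ ws) = if t v ≤ᵇ t w then v ∷ w ∷ ws else w ∷ insertBy v ws

  sortByTime : List (Fin n) → List (Fin n)
  sortByTime = Data.List.foldr insertBy []

  bs rs : List (Fin n)
  bs = sortByTime (filterᵇ (λ v → isPBᵇ (reg v)) (allFin n))
  rs = sortByTime (filterᵇ (λ v → isPRᵇ (reg v)) (allFin n))

  module _ (E : List (Subset n)) where

    lastOfBlueEdgeᵇ lastOfRedEdgeᵇ : Coloring → Fin n → Bool
    lastOfBlueEdgeᵇ c v = any (λ f → blueEdgeᵇ c f ∧ isLastᵇ f v) E
    lastOfRedEdgeᵇ  c v = any (λ f → redEdgeᵇ c f ∧ isLastᵇ f v) E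

    stepB stepR : Coloring → Fin n → Coloring
    stepB c v = if lastOfBlueEdgeᵇ c v then recolor c v red else c
    stepR c v = if lastOfRedEdgeᵇ c v then recolor c v blue else c

    pass : Coloring → Coloring
    pass c = foldl stepR (foldl stepB c bs) rs

    loopCondᵇ : Coloring → Bool
    loopCondᵇ c = any (λ f → (blueEdgeᵇ c f ∧ any (λ v → isLastᵇ f v ∧ isPBᵇ (reg v)) (allFin n))
                           ∨ (redEdgeᵇ c f ∧ any (λ v → isLastᵇ f v ∧ isPRᵇ (reg v)) (allFin n))) E

    loop : ℕ → Coloring → Coloring
    loop zero    c = c
    loop (suc k) c = if loopCondᵇ c then loop k (pass c) else c

    -- Every pass executed while the condition holds recolors at least one
    -- vertex, and each vertex is recolored at most once, so n+1 iterations
    -- of the loop suffice for the loop to stop.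
    MGC : Coloring
    MGC = loop (suc n) initialColoring

    -- Chains: a chain of length r = suc k is s : Fin (suc k) → edges,
    -- with vertex sequence v : Fin k → Fin n.

    record Chain (k : ℕ) : Set where
      field
        s      : Fin (suc k) → Subset n
        v      : Fin k → Fin n
        s∈E    : ∀ j → s j ∈ˡ E
        meet   : ∀ i → s (inject₁ i) ∩ s (suc i) ≡ ⁅ v i ⁆
        v-inj  : Injective _≡_ _≡_ v   -- the sets s_i ∩ s_{i+1} are pairwise disjoint

    open Chain public

    lastIdx : (k : ℕ) → Fin (suc k)
    lastIdx zero    = zero
    lastIdx (suc k) = suc (lastIdx k)

    Alternating : ∀ {k} → Chain k → Set
    Alternating {k} ch =
      (∀ j → (Easy (s ch j) → ⊥) × (Degenerate (s ch j) → ⊥)) ×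
      (∀ i → (∃ λ w → IsLast (s ch (suc i)) w × IsFirst (s ch (inject₁ i)) w)
             × InP (reg (v ch i)))

    Conflicting : ∀ {k} → Chain k → Set
    Conflicting ch = Alternating ch × (∃ λ w → IsLast (s ch zero) w × InBR (reg w))

    CompleteConflicting : ∀ {k} → Chain k → Set
    CompleteConflicting {k} ch =
      Conflicting ch × (∃ λ w → IsFirst (s ch (lastIdx k)) w × InBR (reg w))

-- Only vertices of P_B ∪ P_R are ever recolored, and MGC recolors a vertex w only when w is the last
-- vertex of an edge g that still has w's initial color.  Given an edge f that is monochromatic now, its
-- first vertex w either lies in B ∪ R, where the chain stops, or lies in P and must have been recolored
-- (otherwise f would contain a B ∪ R vertex of the wrong color or before w).  Then f ∩ g = {w}, and we
-- continue with the chain that existed for g when w was recolored.  This is carried as an invariant of MGC: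
-- every recolored vertex stores such a chain, whose link vertices were all recolored before it, which keeps
-- the link vertices distinct.  MGC halts because each pass run under the loop condition recolors a new
-- vertex; once it has halted, the last vertex of a monochromatic edge cannot lie in P, so the chain from
-- that edge is complete conflicting.

module Submission where

open import Defs
open import Data.Nat using (ℕ)
open import Data.Fin using (Fin)
open import Data.Fin.Subset using (Subset)
open import Data.List using (List)
open import Data.List.Membership.Propositional using (_∈_)
open import Data.Rational using (ℚ; 0ℚ; 1ℚ; ½; _≤_; _<_)
open import Data.Product using (_×_; ∃; Σ; _,_)
open import Data.Empty using (⊥)
open import Relation.Binary.PropositionalEquality using (_≡_)
open import Function.Definitions using (Injective)

open import Data.Bool using (Bool; true; false; T; not; _∨_; if_then_else_)
open import Data.Bool.Properties using (T-≡; T-not-≡; T-∧; T-∨; not-injective)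
open import Data.Bool.ListAction using (any; all)
open import Data.Nat using (zero; suc; s≤s) renaming (_<_ to _<ℕ_; _+_ to _+ℕ_)
import Data.Nat.Properties as ℕ
open import Data.Fin using (zero; suc; _≟_; inject₁)
open import Data.Fin.Subset using (inside; outside; _⊆_; _⊂_; _∩_; ⁅_⁆; ∣_∣; Nonempty) renaming (_∈_ to _∈ₛ_; _∉_ to _∉ₛ_)
open import Data.Fin.Subset.Properties using (_∈?_; _⊂?_; ⊂-⊆-trans; ⊆-⊂-trans; p⊂q⇒∣p∣<∣q∣; ∣p∣≤n; ⊆-antisym; x∈p∩q⁺; x∈p∩q⁻; x∈⁅x⁆; x∈⁅y⁆⇒x≡y)
import Data.Fin.Properties as Fin
open import Data.Vec using (lookup; tabulate)
open import Data.Vec.Properties using (lookup∘tabulate; []=⇒lookup; lookup⇒[]=)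
open import Data.List using ([]; _∷_; foldl; filter; filterᵇ)
open import Data.List.Relation.Unary.Any using (here; there)
open import Data.List.Relation.Unary.Any.Properties using (any⁺; any⁻)
open import Data.List.Relation.Unary.All as All using (All; []; _∷_)
open import Data.List.Relation.Unary.All.Properties using (all⁺; all⁻; all-filter)
open import Data.List.Membership.Propositional using (find; lose)
open import Data.List.Membership.Propositional.Properties using (∈-map⁺; ∈-filter⁺)
open import Data.List.Relation.Binary.Permutation.Propositional using (_↭_; ↭-refl; ↭-prep; ↭-swap; ↭-trans; ↭-sym)
open import Data.List.Relation.Binary.Permutation.Propositional.Properties using (∈-resp-↭; All-resp-↭)
open import Data.Rational using (_+_; _-_; -_; _*_; _≤ᵇ_)
import Data.Rational.Properties as ℚP
open import Data.Sum using (_⊎_; inj₁; inj₂; [_,_]′)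
open import Data.Product using (proj₁; proj₂)
open import Function using (_∘_; id; const; case_of_)
open import Function.Bundles using (_⇔_; mk⇔; module Equivalence)
open import Relation.Binary.Bundles using (DecTotalOrder)
open import Data.List.Extrema (DecTotalOrder.totalOrder ℚP.≤-decTotalOrder) using (argmin; argmax; f[argmin]≤f[xs]; f[xs]≤f[argmax]; argmin-all; argmax-all)
open import Relation.Binary.PropositionalEquality using (_≢_; refl; sym; trans; cong; subst; subst₂; _≗_; module ≡-Reasoning)
open import Relation.Nullary using (¬_; Dec; yes; no; does; contradiction)
open import Relation.Nullary.Decidable using (T?; decidable-stable; _×-dec_)
import Relation.Nullary.Decidable as Dec

open Equivalence using (to; from)

T-not-∨ : ∀ {a b} → T (not a ∨ b) ⇔ (T a → T b)
T-not-∨ {true}  = mk⇔ const (λ f → f _)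
T-not-∨ {false} = mk⇔ (λ _ ()) (const _)

T-any : ∀ {A : Set} {P : A → Bool} {xs} → T (any P xs) ⇔ ∃ λ x → x ∈ xs × T (P x)
T-any {P = P} = mk⇔ (find ∘ any⁻ P _) (λ (_ , x∈xs , px) → any⁺ P (lose x∈xs px))

∈-allFin : ∀ {n} (x : Fin n) → x ∈ allFin n
∈-allFin zero    = here refl
∈-allFin (suc x) = there (∈-map⁺ suc (∈-allFin x))

T-any-allFin : ∀ {n} {P : Fin n → Bool} → T (any P (allFin n)) ⇔ ∃ (T ∘ P)
T-any-allFin {P = P} = mk⇔ (λ h → let x , _ , px = to (T-any {P = P} {xs = allFin _}) h in x , px)
                           (λ (x , px) → from (T-any {P = P}) (x , ∈-allFin x , px))

T-all-allFin : ∀ {n} {P : Fin n → Bool} → T (all P (allFin n)) ⇔ (∀ x → T (P x))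
T-all-allFin {P = P} = mk⇔ (λ h x → All.lookup (all⁺ P _ h) (∈-allFin x))
                           (λ h → all⁻ P {xs = allFin _} (All.tabulate (λ {x} _ → h x)))

T-∈ᵇ : ∀ {n} {v : Fin n} {f : Subset n} → T (v ∈ᵇ f) ⇔ v ∈ₛ f
T-∈ᵇ {v = v} {f} with lookup f v in eq
... | inside  = mk⇔ (const (lookup⇒[]= v f eq)) (const _)
... | outside = mk⇔ (λ ()) (λ v∈f → case trans (sym ([]=⇒lookup v∈f)) eq of λ ())

T-all-∈ᵇ : ∀ {n} {f : Subset n} {P : Fin n → Bool} →
           T (all (λ u → not (u ∈ᵇ f) ∨ P u) (allFin n)) ⇔ (∀ u → u ∈ₛ f → T (P u))
T-all-∈ᵇ = mk⇔ (λ h u u∈f → to T-not-∨ (to T-all-allFin h u) (from T-∈ᵇ u∈f))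
               (λ h → from T-all-allFin (λ u → from T-not-∨ (h u ∘ to T-∈ᵇ)))

<ᵇ⇒< : ∀ {x y} → x <ᵇ y ≡ true → x < y
<ᵇ⇒< x<ᵇy = ℚP.≰⇒> (λ y≤x → subst T (to T-not-≡ (from T-≡ x<ᵇy)) (ℚP.≤⇒≤ᵇ y≤x))

≮ᵇ⇒≥ : ∀ {x y} → x <ᵇ y ≡ false → y ≤ x
≮ᵇ⇒≥ x≮ᵇy = ℚP.≤ᵇ⇒≤ (from T-≡ (not-injective x≮ᵇy))

<⇒≱ : ∀ {x y} → x < y → ¬ y ≤ x
<⇒≱ x<y y≤x = ℚP.<-irrefl refl (ℚP.<-≤-trans x<y y≤x)

+-cancelʳ-≤ : ∀ z {x y} → x + z ≤ y + z → x ≤ y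
+-cancelʳ-≤ z {x} {y} = subst₂ _≤_ (+-z-z x) (+-z-z y) ∘ ℚP.+-monoˡ-≤ (- z)
  where
  +-z-z : ∀ a → a + z - z ≡ a
  +-z-z a = trans (ℚP.+-assoc a z (- z)) (trans (cong (a +_) (ℚP.+-inverseʳ z)) (ℚP.+-identityʳ a))

infix 4 _≺_

data _≺_ : Region → Region → Set where
  B≺PB  : B ≺ PB
  B≺R   : B ≺ R
  B≺PR  : B ≺ PR
  PB≺R  : PB ≺ R
  PB≺PR : PB ≺ PR
  R≺PR  : R ≺ PR

PR-maximal : ∀ {r} → ¬ PR ≺ r
PR-maximal ()

-- Each arc keeps every comparison that led to it, so region-strictMono needs no ordering of the cut points.
data ArcView (p x : ℚ) : Region → Set where
  inB  : x < (1ℚ - p) * ½ → ArcView p x B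
  inPB : (1ℚ - p) * ½ ≤ x → x < ½ → ArcView p x PB
  inR  : (1ℚ - p) * ½ ≤ x → ½ ≤ x → x < 1ℚ - p * ½ → ArcView p x R
  inPR : (1ℚ - p) * ½ ≤ x → ½ ≤ x → 1ℚ - p * ½ ≤ x → ArcView p x PR

arcView : ∀ p x → ArcView p x (region p x)
arcView p x with x <ᵇ ((1ℚ - p) * ½) in b | x <ᵇ ½ in pb | x <ᵇ (1ℚ - p * ½) in r
... | true  | _     | _     = inB (<ᵇ⇒< b)
... | false | true  | _     = inPB (≮ᵇ⇒≥ b) (<ᵇ⇒< pb)
... | false | false | true  = inR (≮ᵇ⇒≥ b) (≮ᵇ⇒≥ pb) (<ᵇ⇒< r)
... | false | false | false = inPR (≮ᵇ⇒≥ b) (≮ᵇ⇒≥ pb) (≮ᵇ⇒≥ r)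

region-strictMono : ∀ {p x y r s} → region p x ≡ r → region p y ≡ s → r ≺ s → x < y
region-strictMono {p} {x} {y} refl refl r≺s = compare r≺s (arcView p x) (arcView p y)
  where
  compare : ∀ {r s} → r ≺ s → ArcView p x r → ArcView p y s → x < y
  compare B≺PB  (inB x<)      (inPB ≤y _)    = ℚP.<-≤-trans x< ≤y
  compare B≺R   (inB x<)      (inR ≤y _ _)   = ℚP.<-≤-trans x< ≤y
  compare B≺PR  (inB x<)      (inPR ≤y _ _)  = ℚP.<-≤-trans x< ≤y
  compare PB≺R  (inPB _ x<)   (inR _ ≤y _)   = ℚP.<-≤-trans x< ≤y
  compare PB≺PR (inPB _ x<)   (inPR _ ≤y _)  = ℚP.<-≤-trans x< ≤y
  compare R≺PR  (inR _ _ x<)  (inPR _ _ ≤y)  = ℚP.<-≤-trans x< ≤y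

InBR⊎InP : ∀ r → InBR r ⊎ InP r
InBR⊎InP B  = inj₁ (inj₁ refl)
InBR⊎InP PB = inj₂ (inj₁ refl)
InBR⊎InP R  = inj₁ (inj₂ refl)
InBR⊎InP PR = inj₂ (inj₂ refl)

InBR⇒¬InP : ∀ {r} → InBR r → ¬ InP r
InBR⇒¬InP (inj₁ refl) (inj₁ ())
InBR⇒¬InP (inj₁ refl) (inj₂ ())
InBR⇒¬InP (inj₂ refl) (inj₁ ())
InBR⇒¬InP (inj₂ refl) (inj₂ ())

InBR? : ∀ r → Dec (InBR r)
InBR? r = [ yes , (λ r∈P → no λ r∈BR → InBR⇒¬InP r∈BR r∈P) ]′ (InBR⊎InP r)

T-isPBᵇ : ∀ {r} → T (isPBᵇ r) ⇔ r ≡ PB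
T-isPBᵇ {B}  = mk⇔ (λ ()) (λ ())
T-isPBᵇ {PB} = mk⇔ (const refl) (const _)
T-isPBᵇ {R}  = mk⇔ (λ ()) (λ ())
T-isPBᵇ {PR} = mk⇔ (λ ()) (λ ())

T-isRᵇ : ∀ {r} → T (isRᵇ r) ⇔ r ≡ R
T-isRᵇ {B}  = mk⇔ (λ ()) (λ ())
T-isRᵇ {PB} = mk⇔ (λ ()) (λ ())
T-isRᵇ {R}  = mk⇔ (const refl) (const _)
T-isRᵇ {PR} = mk⇔ (λ ()) (λ ())

T-isPRᵇ : ∀ {r} → T (isPRᵇ r) ⇔ r ≡ PR
T-isPRᵇ {B}  = mk⇔ (λ ()) (λ ())
T-isPRᵇ {PB} = mk⇔ (λ ()) (λ ())
T-isPRᵇ {R}  = mk⇔ (λ ()) (λ ())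
T-isPRᵇ {PR} = mk⇔ (const refl) (const _)

≡PR? : ∀ r → Dec (r ≡ PR)
≡PR? r = Dec.map T-isPRᵇ (T? (isPRᵇ r))

⊆∧⊄⇒⊇ : ∀ {n} {p q : Subset n} → p ⊆ q → ¬ p ⊂ q → q ⊆ p
⊆∧⊄⇒⊇ {p = p} p⊆q p⊄q {x} x∈q with x ∈? p
... | yes x∈p = x∈p
... | no  x∉p = contradiction ((λ {y} → p⊆q {y}) , x , x∈q , x∉p) p⊄q

module _ {n : ℕ} (p : ℚ) (t : Fin n → ℚ) where

  key≡t : ∀ f u → (reg p t u ≡ PR → T (meetsRᵇ p t f)) → key p t f u ≡ t u
  key≡t f u PR⇒meetsR with meetsRᵇ p t f | reg p t u
  ... | true  | _  = refl
  ... | false | B  = refl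
  ... | false | PB = refl
  ... | false | R  = refl
  ... | false | PR = contradiction refl PR⇒meetsR

  key≡t-1 : ∀ f u → ¬ T (meetsRᵇ p t f) → reg p t u ≡ PR → key p t f u ≡ t u - 1ℚ
  key≡t-1 f u ¬meetsR u∈PR with meetsRᵇ p t f | reg p t u
  ... | true  | _  = contradiction _ ¬meetsR
  ... | false | PR = refl

  key-≤⇒t-≤ : ∀ f {u w} → reg p t u ≡ reg p t w → key p t f u ≤ key p t f w → t u ≤ t w
  key-≤⇒t-≤ f {u} {w} same le with T? (meetsRᵇ p t f) | ≡PR? (reg p t w)
  ... | yes meetsR | _ = subst₂ _≤_ (key≡t f u (const meetsR)) (key≡t f w (const meetsR)) le
  ... | no ¬meetsR | yes w∈PR =
    +-cancelʳ-≤ (- 1ℚ) (subst₂ _≤_ (key≡t-1 f u ¬meetsR (trans same w∈PR)) (key≡t-1 f w ¬meetsR w∈PR) le)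
  ... | no _       | no w∉PR =
    subst₂ _≤_ (key≡t f u (λ u∈PR → contradiction (trans (sym same) u∈PR) w∉PR))
               (key≡t f w (λ w∈PR → contradiction w∈PR w∉PR)) le

  key-< : ∀ f {u w r s} → reg p t u ≡ r → reg p t w ≡ s → r ≺ s → (s ≡ PR → T (meetsRᵇ p t f)) →
          key p t f u < key p t f w
  key-< f {u} {w} u∈r w∈s r≺s PR⇒meetsR =
    subst₂ _<_ (sym (key≡t f u u∉PR)) (sym (key≡t f w (PR⇒meetsR ∘ trans (sym w∈s))))
               (region-strictMono {p} u∈r w∈s r≺s)
    where
    u∉PR : reg p t u ≡ PR → T (meetsRᵇ p t f)
    u∉PR u∈PR = contradiction (subst (_≺ _) (trans (sym u∈r) u∈PR) r≺s) PR-maximal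

  -- When f misses R, its arc starts at 1 - p/2, so P_R comes before everything else.
  key-wrap-< : ∀ f {u w} → ¬ T (meetsRᵇ p t f) → reg p t u ≡ PR → reg p t w ≢ PR →
               t u < 1ℚ → 0ℚ ≤ t w → key p t f u < key p t f w
  key-wrap-< f {u} {w} ¬meetsR u∈PR w∉PR tu<1 0≤tw =
    subst₂ _<_ (sym (key≡t-1 f u ¬meetsR u∈PR)) (sym (key≡t f w (λ w∈PR → contradiction w∈PR w∉PR)))
               (ℚP.<-≤-trans (ℚP.+-monoˡ-< (- 1ℚ) tu<1) 0≤tw)

  ∃-first : ∀ {f} → Nonempty f → ∃ (IsFirst p t f)
  ∃-first {f} (u , u∈f) = w , argmin-all (key p t f) u∈f (all-filter (_∈? f) (allFin n)) ,
    λ y y∈f → All.lookup (f[argmin]≤f[xs] {f = key p t f} u members) (∈-filter⁺ (_∈? f) (∈-allFin y) y∈f)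
    where
    members : List (Fin n)
    members = filter (_∈? f) (allFin n)
    w : Fin n
    w = argmin (key p t f) u members

  ∃-last : ∀ {f} → Nonempty f → ∃ (IsLast p t f)
  ∃-last {f} (u , u∈f) = w , argmax-all (key p t f) u∈f (all-filter (_∈? f) (allFin n)) ,
    λ y y∈f → All.lookup (f[xs]≤f[argmax] {f = key p t f} u members) (∈-filter⁺ (_∈? f) (∈-allFin y) y∈f)
    where
    members : List (Fin n)
    members = filter (_∈? f) (allFin n)
    w : Fin n
    w = argmax (key p t f) u members

  nondegenerate⇒∃BR : ∀ {f} → ¬ Degenerate p t f → ∃ λ u → u ∈ₛ f × InBR (reg p t u)
  nondegenerate⇒∃BR {f} ¬degenerate with Fin.any? (λ u → (u ∈? f) ×-dec InBR? (reg p t u))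
  ... | yes (u , u∈f , u∈BR) = u , u∈f , u∈BR
  ... | no ∄ = contradiction (λ u u∈f → [ (λ u∈BR → contradiction (u , u∈f , u∈BR) ∄) , id ]′ (InBR⊎InP (reg p t u)))
                             ¬degenerate

  nondegenerate⇒nonempty : ∀ {f} → ¬ Degenerate p t f → Nonempty f
  nondegenerate⇒nonempty ¬degenerate = let u , u∈f , _ = nondegenerate⇒∃BR ¬degenerate in u , u∈f

  T-meetsRᵇ : ∀ {f} → T (meetsRᵇ p t f) ⇔ ∃ λ u → u ∈ₛ f × reg p t u ≡ R
  T-meetsRᵇ = mk⇔ (λ h → let u , h′ = to T-any-allFin h ; u∈f , u∈R = to T-∧ h′ in u , to T-∈ᵇ u∈f , to T-isRᵇ u∈R)
                  (λ (u , u∈f , u∈R) → from T-any-allFin (u , from T-∧ (from T-∈ᵇ u∈f , from T-isRᵇ u∈R)))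

  T-isLastᵇ : ∀ {f v} → T (isLastᵇ p t f v) ⇔ IsLast p t f v
  T-isLastᵇ = mk⇔ (λ h → let v∈f , le = to T-∧ h in to T-∈ᵇ v∈f , λ u u∈f → ℚP.≤ᵇ⇒≤ (to T-all-∈ᵇ le u u∈f))
                  (λ (v∈f , le) → from T-∧ (from T-∈ᵇ v∈f , from T-all-∈ᵇ (λ u u∈f → ℚP.≤⇒≤ᵇ (le u u∈f))))

  regionColor : Region → Color p t
  regionColor B  = blue
  regionColor PB = blue
  regionColor R  = red
  regionColor PR = red

  initialColoring≡regionColor : ∀ {u r} → reg p t u ≡ r → initialColoring p t u ≡ regionColor r
  initialColoring≡regionColor {u} refl with reg p t u
  ... | B  = refl
  ... | PB = refl
  ... | R  = refl
  ... | PR = refl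

  regionColor-injectiveᴾ : ∀ {r s} → InP r → InP s → regionColor r ≡ regionColor s → r ≡ s
  regionColor-injectiveᴾ (inj₁ refl) (inj₁ refl) _ = refl
  regionColor-injectiveᴾ (inj₂ refl) (inj₂ refl) _ = refl
  regionColor-injectiveᴾ (inj₁ refl) (inj₂ refl) ()
  regionColor-injectiveᴾ (inj₂ refl) (inj₁ refl) ()

  opposite : Color p t → Color p t
  opposite blue = red
  opposite red  = blue

  opposite-≢ : ∀ col → opposite col ≢ col
  opposite-≢ blue ()
  opposite-≢ red  ()

  _≟ᶜ_ : (a b : Color p t) → Dec (a ≡ b)
  blue ≟ᶜ blue = yes refl
  blue ≟ᶜ red  = no λ ()
  red  ≟ᶜ blue = no λ ()
  red  ≟ᶜ red  = yes refl

  ≢⇒opposite : ∀ {a c : Color p t} → a ≢ c → a ≡ opposite c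
  ≢⇒opposite {blue} {blue} a≢c = contradiction refl a≢c
  ≢⇒opposite {blue} {red}  _   = refl
  ≢⇒opposite {red}  {blue} _   = refl
  ≢⇒opposite {red}  {red}  a≢c = contradiction refl a≢c

  ≢-same⇒≡ : ∀ {a b c : Color p t} → a ≢ c → b ≢ c → a ≡ b
  ≢-same⇒≡ a≢c b≢c = trans (≢⇒opposite a≢c) (sym (≢⇒opposite b≢c))

  Mono : Coloring p t → Color p t → Subset n → Set
  Mono c col f = ∀ u → u ∈ₛ f → c u ≡ col

  recolored : Coloring p t → Subset n
  recolored c = tabulate λ u → not (does (c u ≟ᶜ initialColoring p t u))

  ∈-recolored⇔ : ∀ c {u} → u ∈ₛ recolored c ⇔ c u ≢ initialColoring p t u
  ∈-recolored⇔ c {u} with c u ≟ᶜ initialColoring p t u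
                         | lookup∘tabulate (λ u → not (does (c u ≟ᶜ initialColoring p t u))) u
  ... | yes kept  | entry = mk⇔ (λ u∈ → case trans (sym ([]=⇒lookup u∈)) entry of λ ()) (contradiction kept)
  ... | no  moved | entry = mk⇔ (const moved) (const (lookup⇒[]= u _ entry))

  ∉-recolored⇒ : ∀ c {u} → u ∉ₛ recolored c → c u ≡ initialColoring p t u
  ∉-recolored⇒ c {u} u∉ = decidable-stable (c u ≟ᶜ initialColoring p t u) (u∉ ∘ from (∈-recolored⇔ c))

  recolored-agree : ∀ c c′ {u} → u ∈ₛ recolored c → u ∈ₛ recolored c′ → c u ≡ c′ u
  recolored-agree c c′ u∈c u∈c′ = ≢-same⇒≡ (to (∈-recolored⇔ c) u∈c) (to (∈-recolored⇔ c′) u∈c′)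

  recolored-≗ : ∀ c c′ → recolored c ⊆ recolored c′ → recolored c′ ⊆ recolored c → c ≗ c′
  recolored-≗ c c′ c⊆c′ c′⊆c u with u ∈? recolored c
  ... | yes u∈c = recolored-agree c c′ u∈c (c⊆c′ u∈c)
  ... | no  u∉c = trans (∉-recolored⇒ c u∉c) (sym (∉-recolored⇒ c′ (u∉c ∘ c′⊆c)))

  recolor-self : ∀ c x col → recolor p t c x col x ≡ col
  recolor-self c x col with x ≟ x
  ... | yes _   = refl
  ... | no  x≢x = contradiction refl x≢x

  recolor-other : ∀ c x col {u} → u ≢ x → recolor p t c x col u ≡ c u
  recolor-other c x col {u} u≢x with u ≟ x
  ... | yes u≡x = contradiction u≡x u≢x
  ... | no  _   = refl

  module _ {c : Coloring p t} {x : Fin n} {col : Color p t} where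

    x∈recolored-recolor : col ≢ initialColoring p t x → x ∈ₛ recolored (recolor p t c x col)
    x∈recolored-recolor col≢ = from (∈-recolored⇔ (recolor p t c x col)) (col≢ ∘ trans (sym (recolor-self c x col)))

    recolored-recolor⁺ : col ≢ initialColoring p t x → recolored c ⊆ recolored (recolor p t c x col)
    recolored-recolor⁺ col≢ {u} u∈c with u ≟ x
    ... | yes refl = x∈recolored-recolor col≢
    ... | no  u≢x  = from (∈-recolored⇔ (recolor p t c x col))
                          (to (∈-recolored⇔ c) u∈c ∘ trans (sym (recolor-other c x col u≢x)))

    recolored-recolor⁻ : ∀ {u} → u ∈ₛ recolored (recolor p t c x col) → u ≡ x ⊎ u ∈ₛ recolored c
    recolored-recolor⁻ {u} u∈ with u ≟ x
    ... | yes u≡x = inj₁ u≡x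
    ... | no  u≢x = inj₂ (from (∈-recolored⇔ c)
                               (to (∈-recolored⇔ (recolor p t c x col)) u∈ ∘ trans (recolor-other c x col u≢x)))

    recolor-⊂ : c x ≡ initialColoring p t x → col ≢ initialColoring p t x →
                recolored c ⊂ recolored (recolor p t c x col)
    recolor-⊂ kept col≢ = recolored-recolor⁺ col≢ , x , x∈recolored-recolor col≢ , λ x∈c → to (∈-recolored⇔ c) x∈c kept

  record RecoloredInP (c : Coloring p t) : Set where
    field recolored⇒InP : ∀ {u} → u ∈ₛ recolored c → InP (reg p t u)

  open RecoloredInP

  kept-outside-P : ∀ {c u} → RecoloredInP c → InBR (reg p t u) → c u ≡ regionColor (reg p t u)
  kept-outside-P {c} only-P u∈BR =
    trans (∉-recolored⇒ c (InBR⇒¬InP u∈BR ∘ recolored⇒InP only-P)) (initialColoring≡regionColor refl)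

  B-blue : ∀ {c u} → RecoloredInP c → reg p t u ≡ B → c u ≡ blue
  B-blue only-P u∈B = trans (kept-outside-P only-P (inj₁ u∈B)) (cong regionColor u∈B)

  R-red : ∀ {c u} → RecoloredInP c → reg p t u ≡ R → c u ≡ red
  R-red only-P u∈R = trans (kept-outside-P only-P (inj₂ u∈R)) (cong regionColor u∈R)

  mono-¬easy : ∀ {c col f} → RecoloredInP c → Mono c col f → ¬ Easy p t f
  mono-¬easy {c} {col} only-P mono ((u , u∈f , u∈B) , (w , w∈f , w∈R)) = case blue≡red of λ ()
    where
    open ≡-Reasoning
    blue≡red : blue ≡ red
    blue≡red = begin
      blue ≡⟨ B-blue only-P u∈B ⟨
      c u  ≡⟨ mono u u∈f ⟩
      col  ≡⟨ mono w w∈f ⟨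
      c w  ≡⟨ R-red only-P w∈R ⟩
      red  ∎

  mono-first-recolored : ∀ {c col f w} → RecoloredInP c → ¬ Degenerate p t f → Mono c col f →
                         IsFirst p t f w → InP (reg p t w) → w ∈ₛ recolored c
  mono-first-recolored {c} {col} {f} {w} only-P ¬degenerate mono (w∈f , w-first) w∈P =
    from (∈-recolored⇔ c) (cases w∈P (nondegenerate⇒∃BR ¬degenerate))
    where
    first-violated : ∀ {u} → u ∈ₛ f → ¬ key p t f u < key p t f w
    first-violated u∈f u<w = <⇒≱ u<w (w-first _ u∈f)
    differs : ∀ {u} → u ∈ₛ f → c u ≢ initialColoring p t w → c w ≢ initialColoring p t w
    differs u∈f u≢ w-kept = u≢ (trans (trans (mono _ u∈f) (sym (mono w w∈f))) w-kept)
    cases : InP (reg p t w) → (∃ λ u → u ∈ₛ f × InBR (reg p t u)) → c w ≢ initialColoring p t w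
    cases (inj₁ w∈PB) (u , u∈f , inj₁ u∈B) = contradiction (key-< f u∈B w∈PB B≺PB λ ()) (first-violated u∈f)
    cases (inj₁ w∈PB) (u , u∈f , inj₂ u∈R) = differs u∈f λ eq →
      case trans (sym (R-red only-P u∈R)) (trans eq (initialColoring≡regionColor w∈PB)) of λ ()
    cases (inj₂ w∈PR) (u , u∈f , inj₁ u∈B) = differs u∈f λ eq →
      case trans (sym (B-blue only-P u∈B)) (trans eq (initialColoring≡regionColor w∈PR)) of λ ()
    cases (inj₂ w∈PR) (u , u∈f , inj₂ u∈R) =
      contradiction (key-< f u∈R w∈PR R≺PR (const (from T-meetsRᵇ (u , u∈f , u∈R)))) (first-violated u∈f)

  mono-last-initialColor : ∀ {c col f x} → (∀ v → 0ℚ ≤ t v) → (∀ v → t v < 1ℚ) → RecoloredInP c →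
                           ¬ Degenerate p t f → Mono c col f → IsLast p t f x → InP (reg p t x) →
                           col ≡ initialColoring p t x
  mono-last-initialColor {c} {col} {f} {x} 0≤t t<1 only-P ¬degenerate mono (x∈f , x-last) x∈P =
    cases x∈P (nondegenerate⇒∃BR ¬degenerate)
    where
    last-violated : ∀ {u} → u ∈ₛ f → ¬ key p t f x < key p t f u
    last-violated u∈f x<u = <⇒≱ x<u (x-last _ u∈f)
    cases : InP (reg p t x) → (∃ λ u → u ∈ₛ f × InBR (reg p t u)) → col ≡ initialColoring p t x
    cases (inj₁ x∈PB) (u , u∈f , inj₁ u∈B) =
      trans (sym (mono u u∈f)) (trans (B-blue only-P u∈B) (sym (initialColoring≡regionColor x∈PB)))
    cases (inj₁ x∈PB) (u , u∈f , inj₂ u∈R) = contradiction (key-< f x∈PB u∈R PB≺R λ ()) (last-violated u∈f)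
    cases (inj₂ x∈PR) (u , u∈f , inj₁ u∈B) = contradiction
      (key-wrap-< f (λ meetsR → mono-¬easy only-P mono ((u , u∈f , u∈B) , to T-meetsRᵇ meetsR)) x∈PR
                    (λ u∈PR → case trans (sym u∈B) u∈PR of λ ()) (t<1 x) (0≤t u))
      (last-violated u∈f)
    cases (inj₂ x∈PR) (u , u∈f , inj₂ u∈R) =
      trans (sym (mono u u∈f)) (trans (R-red only-P u∈R) (sym (initialColoring≡regionColor x∈PR)))

  Mono-resp-≗ : ∀ {c c′ col f} → c ≗ c′ → Mono c col f → Mono c′ col f
  Mono-resp-≗ c≗c′ mono u u∈f = trans (sym (c≗c′ u)) (mono u u∈f)

  T-blueEdgeᵇ : ∀ {c f} → T (blueEdgeᵇ p t c f) ⇔ Mono c blue f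
  T-blueEdgeᵇ {c} = mk⇔ (λ h u u∈f → isBlue (c u) (to T-all-∈ᵇ h u u∈f))
                        (λ mono → from T-all-∈ᵇ (λ u u∈f → subst (T ∘ isBlueᵇ p t) (sym (mono u u∈f)) _))
    where
    isBlue : ∀ col → T (isBlueᵇ p t col) → col ≡ blue
    isBlue blue _ = refl

  T-redEdgeᵇ : ∀ {c f} → T (redEdgeᵇ p t c f) ⇔ Mono c red f
  T-redEdgeᵇ {c} = mk⇔ (λ h u u∈f → isRed (c u) (to T-all-∈ᵇ h u u∈f))
                       (λ mono → from T-all-∈ᵇ (λ u u∈f → subst (T ∘ isRedᵇ p t) (sym (mono u u∈f)) _))
    where
    isRed : ∀ col → T (isRedᵇ p t col) → col ≡ red
    isRed red _ = refl

  insertBy-↭ : ∀ v ws → insertBy p t v ws ↭ v ∷ ws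
  insertBy-↭ v []       = ↭-refl
  insertBy-↭ v (w ∷ ws) with t v ≤ᵇ t w
  ... | true  = ↭-refl
  ... | false = ↭-trans (↭-prep w (insertBy-↭ v ws)) (↭-swap w v ↭-refl)

  sortByTime-↭ : ∀ vs → sortByTime p t vs ↭ vs
  sortByTime-↭ []       = ↭-refl
  sortByTime-↭ (v ∷ vs) = ↭-trans (insertBy-↭ v _) (↭-prep v (sortByTime-↭ vs))

  module ArcVertices {r : Region} (isᵇ : Region → Bool) (T-isᵇ : ∀ {s} → T (isᵇ s) ⇔ s ≡ r) where

    sorted : List (Fin n)
    sorted = sortByTime p t (filterᵇ (isᵇ ∘ reg p t) (allFin n))

    All-sorted : All (λ x → reg p t x ≡ r) sorted
    All-sorted = All-resp-↭ (↭-sym (sortByTime-↭ _)) (All.map (to T-isᵇ) (all-filter (T? ∘ isᵇ ∘ reg p t) (allFin n)))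

    ∈-sorted : ∀ {x} → reg p t x ≡ r → x ∈ sorted
    ∈-sorted {x} x∈r = ∈-resp-↭ (↭-sym (sortByTime-↭ _)) (∈-filter⁺ (T? ∘ isᵇ ∘ reg p t) (∈-allFin x) (from T-isᵇ x∈r))

  open ArcVertices isPBᵇ T-isPBᵇ using () renaming (All-sorted to All-bs; ∈-sorted to ∈-bs)
  open ArcVertices isPRᵇ T-isPRᵇ using () renaming (All-sorted to All-rs; ∈-sorted to ∈-rs)

  module _ (E : List (Subset n)) where

    LastOfMono : Coloring p t → Color p t → Fin n → Set
    LastOfMono c col x = ∃ λ g → g ∈ E × IsLast p t g x × Mono c col g

    T-lastOfBlueEdgeᵇ : ∀ {c x} → T (lastOfBlueEdgeᵇ p t E c x) ⇔ LastOfMono c blue x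
    T-lastOfBlueEdgeᵇ = mk⇔
      (λ h → let g , g∈E , h′ = to T-any h ; mono , last = to T-∧ h′ in g , g∈E , to T-isLastᵇ last , to T-blueEdgeᵇ mono)
      (λ (g , g∈E , last , mono) → from T-any (g , g∈E , from T-∧ (from T-blueEdgeᵇ mono , from T-isLastᵇ last)))

    T-lastOfRedEdgeᵇ : ∀ {c x} → T (lastOfRedEdgeᵇ p t E c x) ⇔ LastOfMono c red x
    T-lastOfRedEdgeᵇ = mk⇔
      (λ h → let g , g∈E , h′ = to T-any h ; mono , last = to T-∧ h′ in g , g∈E , to T-isLastᵇ last , to T-redEdgeᵇ mono)
      (λ (g , g∈E , last , mono) → from T-any (g , g∈E , from T-∧ (from T-redEdgeᵇ mono , from T-isLastᵇ last)))

    Pending : Coloring p t → Region → Fin n → Set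
    Pending c r x = reg p t x ≡ r × LastOfMono c (regionColor r) x

    T-loopCondᵇ : ∀ {c} → T (loopCondᵇ p t E c) ⇔ (∃ (Pending c PB) ⊎ ∃ (Pending c PR))
    T-loopCondᵇ = mk⇔ sound complete
      where
      sound : ∀ {c} → T (loopCondᵇ p t E c) → ∃ (Pending c PB) ⊎ ∃ (Pending c PR)
      sound h with to T-any h
      ... | g , g∈E , h′ with to T-∨ h′
      ...   | inj₁ blue-g = let mono , ∃x = to T-∧ blue-g ; x , h″ = to T-any-allFin ∃x ; last , x∈PB = to T-∧ h″ in
                            inj₁ (x , to T-isPBᵇ x∈PB , g , g∈E , to T-isLastᵇ last , to T-blueEdgeᵇ mono)
      ...   | inj₂ red-g  = let mono , ∃x = to T-∧ red-g ; x , h″ = to T-any-allFin ∃x ; last , x∈PR = to T-∧ h″ in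
                            inj₂ (x , to T-isPRᵇ x∈PR , g , g∈E , to T-isLastᵇ last , to T-redEdgeᵇ mono)
      complete : ∀ {c} → ∃ (Pending c PB) ⊎ ∃ (Pending c PR) → T (loopCondᵇ p t E c)
      complete (inj₁ (x , x∈PB , g , g∈E , last , mono)) = from T-any (g , g∈E , from T-∨ (inj₁
        (from T-∧ (from T-blueEdgeᵇ mono , from T-any-allFin (x , from T-∧ (from T-isLastᵇ last , from T-isPBᵇ x∈PB))))))
      complete (inj₂ (x , x∈PR , g , g∈E , last , mono)) = from T-any (g , g∈E , from T-∨ (inj₂
        (from T-∧ (from T-redEdgeᵇ mono , from T-any-allFin (x , from T-∧ (from T-isLastᵇ last , from T-isPRᵇ x∈PR))))))

    module Phase (r : Region) (lastᵇ : Coloring p t → Fin n → Bool)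
                 (T-lastᵇ : ∀ {c x} → T (lastᵇ c x) ⇔ LastOfMono c (regionColor r) x) where

      step : Coloring p t → Fin n → Coloring p t
      step c x = if lastᵇ c x then recolor p t c x (opposite (regionColor r)) else c

      data StepView (c : Coloring p t) (x : Fin n) : Coloring p t → Set where
        recolors : LastOfMono c (regionColor r) x → StepView c x (recolor p t c x (opposite (regionColor r)))
        keeps    : ¬ LastOfMono c (regionColor r) x → StepView c x c

      stepView : ∀ c x → StepView c x (step c x)
      stepView c x with lastᵇ c x | T-lastᵇ {c} {x}
      ... | true  | h = recolors (to h _)
      ... | false | h = keeps (from h)

      opposite≢initial : ∀ {x} → reg p t x ≡ r → opposite (regionColor r) ≢ initialColoring p t x
      opposite≢initial x∈r eq = opposite-≢ _ (trans eq (initialColoring≡regionColor x∈r))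

      lastOfMono-kept : ∀ {c x} → reg p t x ≡ r → LastOfMono c (regionColor r) x → c x ≡ initialColoring p t x
      lastOfMono-kept x∈r (g , _ , (x∈g , _) , mono) = trans (mono _ x∈g) (sym (initialColoring≡regionColor x∈r))

      step-⊆ : ∀ {c x} → reg p t x ≡ r → recolored c ⊆ recolored (step c x)
      step-⊆ {c} {x} x∈r = viewed (stepView c x)
        where
        viewed : ∀ {c′} → StepView c x c′ → recolored c ⊆ recolored c′
        viewed (recolors _) = recolored-recolor⁺ (opposite≢initial x∈r)
        viewed (keeps _)    = id

      fold-⊆ : ∀ {c xs} → All (λ x → reg p t x ≡ r) xs → recolored c ⊆ recolored (foldl step c xs)
      fold-⊆ []             = id
      fold-⊆ (x∈r ∷ xs⊆r) = fold-⊆ xs⊆r ∘ step-⊆ x∈r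

      fold-⊂ : ∀ {c x xs} → All (λ x → reg p t x ≡ r) xs → x ∈ xs → LastOfMono c (regionColor r) x →
               recolored c ⊂ recolored (foldl step c xs)
      fold-⊂ {c} {x} {y ∷ ys} (y∈r ∷ ys⊆r) x∈y∷ys x-last = viewed (stepView c y)
        where
        viewed : ∀ {c′} → StepView c y c′ → recolored c ⊂ recolored (foldl step c′ ys)
        viewed (recolors y-last) = ⊂-⊆-trans (recolor-⊂ (lastOfMono-kept y∈r y-last) (opposite≢initial y∈r)) (fold-⊆ ys⊆r)
        viewed (keeps ¬y-last)   = case x∈y∷ys of λ
          { (here refl)  → contradiction x-last ¬y-last
          ; (there x∈ys) → fold-⊂ ys⊆r x∈ys x-last }

    module BluePhase = Phase PB (lastOfBlueEdgeᵇ p t E) T-lastOfBlueEdgeᵇ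
    module RedPhase  = Phase PR (lastOfRedEdgeᵇ p t E) T-lastOfRedEdgeᵇ

    LastOfMono-resp-≗ : ∀ {c c′ col x} → c ≗ c′ → LastOfMono c col x → LastOfMono c′ col x
    LastOfMono-resp-≗ c≗c′ (g , g∈E , last , mono) = g , g∈E , last , Mono-resp-≗ c≗c′ mono

    -- Either the blue half recolors something, or it leaves c unchanged and the red half fires at x.
    pendingPR⇒pass-⊂ : ∀ {c x} → Pending c PR x → recolored c ⊂ recolored (pass p t E c)
    pendingPR⇒pass-⊂ {c} (x∈PR , x-last) = case recolored c ⊂? recolored c″ of λ
      { (yes c⊂c″) → ⊂-⊆-trans c⊂c″ (RedPhase.fold-⊆ All-rs)
      ; (no c⊄c″)  → ⊆-⊂-trans c⊆c″
          (RedPhase.fold-⊂ All-rs (∈-rs x∈PR)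
            (LastOfMono-resp-≗ (recolored-≗ c c″ c⊆c″ (⊆∧⊄⇒⊇ c⊆c″ c⊄c″)) x-last)) }
      where
      c″ : Coloring p t
      c″ = foldl (stepB p t E) c (bs p t)
      c⊆c″ : recolored c ⊆ recolored c″
      c⊆c″ = BluePhase.fold-⊆ All-bs

    pass-⊂ : ∀ {c} → T (loopCondᵇ p t E c) → recolored c ⊂ recolored (pass p t E c)
    pass-⊂ cond = [ (λ (x , x∈PB , x-last) → ⊂-⊆-trans (BluePhase.fold-⊂ All-bs (∈-bs x∈PB) x-last)
                                                       (RedPhase.fold-⊆ All-rs))
                  , (λ (x , pending) → pendingPR⇒pass-⊂ pending)
                  ]′ (to T-loopCondᵇ cond)

    loop-halts : ∀ k c → n <ℕ k +ℕ ∣ recolored c ∣ → ¬ T (loopCondᵇ p t E (loop p t E k c))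
    loop-halts zero    c n<∣c∣ = contradiction (∣p∣≤n (recolored c)) (ℕ.<⇒≱ n<∣c∣)
    loop-halts (suc k) c bound = unfold (loopCondᵇ p t E c) refl
      where
      unfold : ∀ b → loopCondᵇ p t E c ≡ b → ¬ T (loopCondᵇ p t E (if b then loop p t E k (pass p t E c) else c))
      unfold false cond = subst T cond
      unfold true  cond = loop-halts k (pass p t E c) (ℕ.<-≤-trans bound (begin
        suc k +ℕ ∣ recolored c ∣              ≡⟨ ℕ.+-suc k _ ⟨
        k +ℕ suc ∣ recolored c ∣              ≤⟨ ℕ.+-monoʳ-≤ k (p⊂q⇒∣p∣<∣q∣ (pass-⊂ (from T-≡ cond))) ⟩
        k +ℕ ∣ recolored (pass p t E c) ∣ ∎))
        where open ℕ.≤-Reasoning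

    MGC-halts : ¬ T (loopCondᵇ p t E (MGC p t E))
    MGC-halts = loop-halts (suc n) (initialColoring p t) (s≤s (ℕ.m≤m+n n _))

    -- An alternating chain s₁ = f, …, s_r whose far end is already complete; it is complete conflicting
    -- as soon as the last vertex of f lies in B ∪ R.
    record ChainFrom (c : Coloring p t) (f : Subset n) : Set where
      field
        {len}           : ℕ
        chain           : Chain p t E len
        starts          : s chain zero ≡ f
        alternating     : Alternating p t E chain
        ends            : ∃ λ w → IsFirst p t (s chain (lastIdx p t E len)) w × InBR (reg p t w)
        links-recolored : ∀ i → v chain i ∈ₛ recolored c

    -- The coloring just before w was recolored, and the monochromatic edge that caused it.
    record Witness (c : Coloring p t) (w : Fin n) : Set where
      field
        before     : Coloring p t
        before⊆    : recolored before ⊆ recolored c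
        w-kept     : w ∉ₛ recolored before
        edge       : Subset n
        w-last     : IsLast p t edge w
        edge-mono  : Mono before (initialColoring p t w) edge
        edge-chain : ChainFrom before edge

    record Invariant (c : Coloring p t) : Set where
      field
        recoloredInP : RecoloredInP c
        witness      : ∀ {w} → w ∈ₛ recolored c → Witness c w

    witness-mono : ∀ {c c′ w} → recolored c ⊆ recolored c′ → Witness c w → Witness c′ w
    witness-mono c⊆c′ W = record { Witness W hiding (before⊆) ; before⊆ = c⊆c′ ∘ Witness.before⊆ W }

    initial-invariant : Invariant (initialColoring p t)
    initial-invariant = record
      { recoloredInP = record { recolored⇒InP = λ u∈ → contradiction refl (to (∈-recolored⇔ (initialColoring p t)) u∈) }
      ; witness      = λ w∈ → contradiction refl (to (∈-recolored⇔ (initialColoring p t)) w∈) }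

    halted⇒last-BR : ∀ {c col f x} → (∀ v → 0ℚ ≤ t v) → (∀ v → t v < 1ℚ) → RecoloredInP c →
                     ¬ T (loopCondᵇ p t E c) → f ∈ E → ¬ Degenerate p t f → Mono c col f → IsLast p t f x →
                     InBR (reg p t x)
    halted⇒last-BR {c} {col} {f} {x} 0≤t t<1 only-P halted f∈E ¬degenerate mono last =
      [ id , (λ x∈P → contradiction (from T-loopCondᵇ (pending x∈P)) halted) ]′ (InBR⊎InP (reg p t x))
      where
      col≡ : InP (reg p t x) → col ≡ initialColoring p t x
      col≡ = mono-last-initialColor 0≤t t<1 only-P ¬degenerate mono last
      pending : InP (reg p t x) → ∃ (Pending c PB) ⊎ ∃ (Pending c PR)
      pending (inj₁ x∈PB) = inj₁ (x , x∈PB , f , f∈E , last ,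
        subst (λ col → Mono c col f) (trans (col≡ (inj₁ x∈PB)) (initialColoring≡regionColor x∈PB)) mono)
      pending (inj₂ x∈PR) = inj₂ (x , x∈PR , f , f∈E , last ,
        subst (λ col → Mono c col f) (trans (col≡ (inj₂ x∈PR)) (initialColoring≡regionColor x∈PR)) mono)

    chainFrom-base : ∀ {c f w} → f ∈ E → ¬ Easy p t f × ¬ Degenerate p t f → IsFirst p t f w → InBR (reg p t w) →
                     ChainFrom c f
    chainFrom-base {f = f} {w} f∈E ordinary first w∈BR = record
      { len             = 0
      ; chain           = record { s = const f ; v = λ () ; s∈E = const f∈E ; meet = λ () ; v-inj = λ {i} → case i of λ () }
      ; starts          = refl
      ; alternating     = const ordinary , λ ()
      ; ends            = w , first , w∈BR
      ; links-recolored = λ ()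
      }

    chainFrom-cons : ∀ {c f w} → f ∈ E → ¬ Easy p t f × ¬ Degenerate p t f → IsFirst p t f w → InP (reg p t w) →
                     w ∈ₛ recolored c → (W : Witness c w) → f ∩ Witness.edge W ≡ ⁅ w ⁆ → ChainFrom c f
    chainFrom-cons {c} {f} {w} f∈E ordinary first w∈P w∈c W f∩edge≡w = record
      { chain           = record { s = s′ ; v = v′ ; s∈E = s∈E′ ; meet = meet′ ; v-inj = v-inj′ }
      ; starts          = refl
      ; alternating     = edges′ , links′
      ; ends            = Tail.ends
      ; links-recolored = links-recolored′
      }
      where
      open Witness W
      module Tail = ChainFrom edge-chain

      s′ : Fin (suc (suc Tail.len)) → Subset n
      s′ zero    = f
      s′ (suc j) = s Tail.chain j

      v′ : Fin (suc Tail.len) → Fin n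
      v′ zero    = w
      v′ (suc i) = v Tail.chain i

      s∈E′ : ∀ j → s′ j ∈ E
      s∈E′ zero    = f∈E
      s∈E′ (suc j) = s∈E Tail.chain j

      meet′ : ∀ i → s′ (inject₁ i) ∩ s′ (suc i) ≡ ⁅ v′ i ⁆
      meet′ zero    = trans (cong (f ∩_) Tail.starts) f∩edge≡w
      meet′ (suc i) = meet Tail.chain i

      w∉tail : ∀ i → w ≢ v Tail.chain i
      w∉tail i w≡vᵢ = w-kept (subst (_∈ₛ recolored before) (sym w≡vᵢ) (Tail.links-recolored i))

      v-inj′ : Injective _≡_ _≡_ v′
      v-inj′ {zero}  {zero}  _ = refl
      v-inj′ {zero}  {suc j} w≡vⱼ = contradiction w≡vⱼ (w∉tail j)
      v-inj′ {suc i} {zero}  vᵢ≡w = contradiction (sym vᵢ≡w) (w∉tail i)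
      v-inj′ {suc i} {suc j} vᵢ≡vⱼ = cong suc (v-inj Tail.chain vᵢ≡vⱼ)

      edges′ : ∀ j → ¬ Easy p t (s′ j) × ¬ Degenerate p t (s′ j)
      edges′ zero    = ordinary
      edges′ (suc j) = proj₁ Tail.alternating j

      links′ : ∀ i → (∃ λ u → IsLast p t (s′ (suc i)) u × IsFirst p t (s′ (inject₁ i)) u) × InP (reg p t (v′ i))
      links′ zero    = (w , subst (λ g → IsLast p t g w) (sym Tail.starts) w-last , first) , w∈P
      links′ (suc i) = proj₂ Tail.alternating i

      links-recolored′ : ∀ i → v′ i ∈ₛ recolored c
      links-recolored′ zero    = w∈c
      links-recolored′ (suc i) = before⊆ (Tail.links-recolored i)

    module _ (t-inj : Injective _≡_ _≡_ t) (nondegenerate : ∀ f → f ∈ E → ¬ Degenerate p t f) where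

      -- A common vertex x now has f's color, not w's initial color, but had w's initial color just before w
      -- was recolored; so x is recolored, hence in P and in w's arc, where it cannot be both after w (in f)
      -- and before w (in the witness edge) unless x = w.
      link-meet : ∀ {c col f w} → RecoloredInP c → Mono c col f → IsFirst p t f w → w ∈ₛ recolored c →
                  (W : Witness c w) → f ∩ Witness.edge W ≡ ⁅ w ⁆
      link-meet {c} {col} {f} {w} only-P mono (w∈f , w-first) w∈c W = ⊆-antisym
        (λ x∈f∩g → let x∈f , x∈g = x∈p∩q⁻ f edge x∈f∩g in
                   subst (_∈ₛ ⁅ w ⁆) (sym (common≡w x∈f x∈g)) (x∈⁅x⁆ w))
        (λ x∈⁅w⁆ → subst (_∈ₛ f ∩ edge) (sym (x∈⁅y⁆⇒x≡y w x∈⁅w⁆)) (x∈p∩q⁺ (w∈f , proj₁ w-last)))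
        where
        open Witness W
        common≡w : ∀ {x} → x ∈ₛ f → x ∈ₛ edge → x ≡ w
        common≡w {x} x∈f x∈g =
          t-inj (ℚP.≤-antisym (key-≤⇒t-≤ edge same-arc (proj₂ w-last x x∈g))
                              (key-≤⇒t-≤ f (sym same-arc) (w-first x x∈f)))
          where
          moved : c x ≢ initialColoring p t w
          moved = to (∈-recolored⇔ c) w∈c ∘ trans (trans (mono w w∈f) (sym (mono x x∈f)))
          kept-before : x ∉ₛ recolored before
          kept-before x∈b = moved (trans (recolored-agree c before (before⊆ x∈b) x∈b) (edge-mono x x∈g))
          same-initial : initialColoring p t x ≡ initialColoring p t w
          same-initial = trans (sym (∉-recolored⇒ before kept-before)) (edge-mono x x∈g)
          x∈c : x ∈ₛ recolored c
          x∈c = from (∈-recolored⇔ c) (moved ∘ λ kept → trans kept same-initial)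
          same-arc : reg p t x ≡ reg p t w
          same-arc = regionColor-injectiveᴾ (recolored⇒InP only-P x∈c) (recolored⇒InP only-P w∈c)
            (trans (sym (initialColoring≡regionColor refl)) (trans same-initial (initialColoring≡regionColor refl)))

      mono⇒chainFrom : ∀ {c col f} → Invariant c → f ∈ E → Mono c col f → ChainFrom c f
      mono⇒chainFrom {c} {col} {f} I f∈E mono = from-first (proj₂ (∃-first (nondegenerate⇒nonempty (proj₂ ordinary))))
        where
        open Invariant I
        ordinary : ¬ Easy p t f × ¬ Degenerate p t f
        ordinary = mono-¬easy recoloredInP mono , nondegenerate f f∈E
        from-first : ∀ {w} → IsFirst p t f w → ChainFrom c f
        from-first {w} first = [ chainFrom-base f∈E ordinary first , from-P ]′ (InBR⊎InP (reg p t w))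
          where
          from-P : InP (reg p t w) → ChainFrom c f
          from-P w∈P = chainFrom-cons f∈E ordinary first w∈P w∈c (witness w∈c)
                                      (link-meet recoloredInP mono first w∈c (witness w∈c))
            where
            w∈c : w ∈ₛ recolored c
            w∈c = mono-first-recolored recoloredInP (proj₂ ordinary) mono first w∈P

      module PhaseInvariant (r : Region) (r∈P : InP r) (lastᵇ : Coloring p t → Fin n → Bool)
                            (T-lastᵇ : ∀ {c x} → T (lastᵇ c x) ⇔ LastOfMono c (regionColor r) x) where

        open Phase r lastᵇ T-lastᵇ

        recolor-invariant : ∀ {c x} → reg p t x ≡ r → LastOfMono c (regionColor r) x → Invariant c →
                            Invariant (recolor p t c x (opposite (regionColor r)))
        recolor-invariant {c} {x} x∈r x-last@(g , g∈E , last , mono) I = record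
          { recoloredInP = record { recolored⇒InP = [ (λ { refl → subst InP (sym x∈r) r∈P }) , recolored⇒InP recoloredInP ]′
                                                   ∘ recolored-recolor⁻ }
          ; witness      = [ (λ { refl → now }) , witness-mono c⊆c′ ∘ witness ]′ ∘ recolored-recolor⁻
          }
          where
          open Invariant I
          c⊆c′ : recolored c ⊆ recolored (recolor p t c x (opposite (regionColor r)))
          c⊆c′ = recolored-recolor⁺ (opposite≢initial x∈r)
          now : Witness (recolor p t c x (opposite (regionColor r))) x
          now = record
            { before     = c
            ; before⊆    = c⊆c′
            ; w-kept     = λ x∈c → to (∈-recolored⇔ c) x∈c (lastOfMono-kept x∈r x-last)
            ; edge       = g
            ; w-last     = last
            ; edge-mono  = subst (λ col → Mono c col g) (sym (initialColoring≡regionColor x∈r)) mono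
            ; edge-chain = mono⇒chainFrom I g∈E mono
            }

        fold-invariant : ∀ {c xs} → All (λ x → reg p t x ≡ r) xs → Invariant c → Invariant (foldl step c xs)
        fold-invariant []                         I = I
        fold-invariant {c} {x ∷ _} (x∈r ∷ xs⊆r) I = fold-invariant xs⊆r (viewed (stepView c x))
          where
          viewed : ∀ {c′} → StepView c x c′ → Invariant c′
          viewed (recolors x-last) = recolor-invariant x∈r x-last I
          viewed (keeps _)         = I

      module BlueInvariant = PhaseInvariant PB (inj₁ refl) (lastOfBlueEdgeᵇ p t E) T-lastOfBlueEdgeᵇ
      module RedInvariant  = PhaseInvariant PR (inj₂ refl) (lastOfRedEdgeᵇ p t E) T-lastOfRedEdgeᵇ

      loop-invariant : ∀ k c → Invariant c → Invariant (loop p t E k c)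
      loop-invariant zero    c I = I
      loop-invariant (suc k) c I = unfold (loopCondᵇ p t E c)
        where
        unfold : ∀ b → Invariant (if b then loop p t E k (pass p t E c) else c)
        unfold false = I
        unfold true  = loop-invariant k (pass p t E c)
                                      (RedInvariant.fold-invariant All-rs (BlueInvariant.fold-invariant All-bs I))

      MGC-invariant : Invariant (MGC p t E)
      MGC-invariant = loop-invariant (suc n) (initialColoring p t) initial-invariant

      mono⇒completeConflicting : ∀ {col f} → (∀ v → 0ℚ ≤ t v) → (∀ v → t v < 1ℚ) → f ∈ E →
                                 Mono (MGC p t E) col f → ∃ λ k → Σ (Chain p t E k) (CompleteConflicting p t E)
      mono⇒completeConflicting {col} {f} 0≤t t<1 f∈E mono =
        from-last (proj₂ (∃-last (nondegenerate⇒nonempty (nondegenerate f f∈E))))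
        where
        open ChainFrom (mono⇒chainFrom MGC-invariant f∈E mono)
        from-last : ∀ {x} → IsLast p t f x → ∃ λ k → Σ (Chain p t E k) (CompleteConflicting p t E)
        from-last {x} last = len , chain , (alternating , x , subst (λ g → IsLast p t g x) (sym starts) last , x∈BR) , ends
          where
          x∈BR : InBR (reg p t x)
          x∈BR = halted⇒last-BR 0≤t t<1 (Invariant.recoloredInP MGC-invariant) MGC-halts
                                f∈E (nondegenerate f f∈E) mono last

proposition8 : (n : ℕ) (E : List (Subset n)) (p : ℚ) (t : Fin n → ℚ) →
    0ℚ < p → p < ½ →
    (∀ v → 0ℚ ≤ t v) → (∀ v → t v < 1ℚ) →
    Injective _≡_ _≡_ t →
    (∀ f → f ∈ E → Degenerate p t f → ⊥) →
    (∃ λ f → f ∈ E × Monochromatic p t (MGC p t E) f) →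
    ∃ λ k → Σ (Chain p t E k) λ ch → CompleteConflicting p t E ch
proposition8 n E p t _ _ 0≤t t<1 t-inj nondegenerate (f , f∈E , mono) =
  [ conflicting , conflicting ]′ mono
  where
  conflicting : ∀ {col} → Mono p t (MGC p t E) col f → ∃ λ k → Σ (Chain p t E k) (CompleteConflicting p t E)
  conflicting = mono⇒completeConflicting p t E t-inj nondegenerate 0≤t t<1 f∈E
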